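{- If $w,w'\in\mathbb{R}^E$ are non-negative feasible weight vectors and $f'\in\mathbb{R}^E$ is a sub-flow of $f:=w'-w$, then both $w+f'$ and $w'-f'$ are non-negative and feasible.
   Context: An election instance consists of a finite bipartite graph $G=(N\cup C,E)$ ($N$ = voters, $C$ = candidates), a vector $s\in\mathbb{R}^N$ of non-negative vote strengths. Write $nc$ for $\{n,c\}$, $C_n=\{c: nc\in E\}$, $N_c=\{n: nc\in E\}$. A weight vector $w\in\mathbb{R}^E$ is feasible if $\sum_{c\in C_n}w_{nc}\le s_n$ for every $n\in N$. A vector $f\in\mathbb{R}^E$ is viewed as a flow, positive entries meaning flow directed toward $C$; the excess of $n\in N$ is $f(n)=\sum_{c\in C_n}f_{nc}$ and the excess of $c\in C$ is $f(c)=-\sum_{n\in N_c}f_{nc}$. A vector $f'\in\mathbb{R}^E$ is a sub-flow of $f$ if (a) for every edge $e$ with $f'_e\neq0$, $f'_e$ and $f_e$ have the same sign and $|f'_e|\le|f_e|$, and (b) for every vertex $x$ with $f'(x)\ne0$, $f'(x)$ and $f(x)$ have the same sign and $|f'(x)|\le|f(x)|$. -}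

module Defs where

open import Level using (Level; suc; _⊔_)
open import Data.Nat using (ℕ)
open import Data.Fin using (Fin; _≟_)
open import Data.Fin.Base using () renaming (zero to fz; suc to fs)
open import Data.Bool using (if_then_else_)
open import Data.Product using (_×_; Σ)
open import Data.Sum using (_⊎_)
open import Relation.Nullary using (¬_)
open import Relation.Nullary.Decidable using (⌊_⌋)
open import Relation.Binary.Structures using (IsTotalOrder)
open import Relation.Binary.PropositionalEquality using (_≡_)
open import Algebra.Bundles using (CommutativeRing)

-- An ordered field (the real numbers are an instance): a commutative ring
-- (with setoid equality ≈) carrying a total order compatible with + and *,
-- in which 0 ≉ 1 and every nonzero element has a multiplicative inverse.
record OrderedField (c ℓ₁ ℓ₂ : Level) : Set (suc (c ⊔ ℓ₁ ⊔ ℓ₂)) where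
  field
    commRing : CommutativeRing c ℓ₁
  open CommutativeRing commRing public
  infix 4 _≤_
  field
    _≤_           : Carrier → Carrier → Set ℓ₂
    isTotalOrder  : IsTotalOrder _≈_ _≤_
    +-mono-≤      : ∀ {x y} z → x ≤ y → x + z ≤ y + z
    *-nonneg      : ∀ {x y} → 0# ≤ x → 0# ≤ y → 0# ≤ x * y
    0≉1           : ¬ (0# ≈ 1#)
    inverse       : ∀ x → ¬ (x ≈ 0#) → Σ Carrier (λ y → x * y ≈ 1#)

module Election {c ℓ₁ ℓ₂} (F : OrderedField c ℓ₁ ℓ₂) where
  open OrderedField F

  infix 4 _<_
  _<_ : Carrier → Carrier → Set (ℓ₁ ⊔ ℓ₂)
  x < y = x ≤ y × ¬ (x ≈ y)

  sumFin : ∀ {k : ℕ} → (Fin k → Carrier) → Carrier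
  sumFin {ℕ.zero}  g = 0#
  sumFin {ℕ.suc k} g = g fz + sumFin (λ i → g (fs i))

  -- Graph with voters Fin n, candidates Fin m, and edges Fin k;
  -- edge e joins voter (src e) and candidate (dst e).
  -- Excess of voter v:  f(v) = Σ_{c ∈ C_v} f_{vc}
  excessN : ∀ {n m k : ℕ} → (Fin k → Fin n) → (Fin k → Fin m) →
            (Fin k → Carrier) → Fin n → Carrier
  excessN src dst f v = sumFin (λ e → if ⌊ src e ≟ v ⌋ then f e else 0#)

  excessC : ∀ {n m k : ℕ} → (Fin k → Fin n) → (Fin k → Fin m) →
            (Fin k → Carrier) → Fin m → Carrier
  excessC src dst f c = - sumFin (λ e → if ⌊ dst e ≟ c ⌋ then f e else 0#)

  -- "a ≠ 0 implies a, b have the same sign and |a| ≤ |b|", written out: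
  -- either a = 0, or 0 < a ≤ b, or b ≤ a < 0.
  SignDominated : Carrier → Carrier → Set (ℓ₁ ⊔ ℓ₂)
  SignDominated a b = (a ≈ 0#) ⊎ ((0# < a × a ≤ b) ⊎ (a < 0# × b ≤ a))

  SubFlow : ∀ {n m k : ℕ} → (Fin k → Fin n) → (Fin k → Fin m) →
            (f' f : Fin k → Carrier) → Set (ℓ₁ ⊔ ℓ₂)
  SubFlow src dst f' f =
    (∀ e → SignDominated (f' e) (f e)) ×
    ((∀ v → SignDominated (excessN src dst f' v) (excessN src dst f v)) ×
     (∀ c → SignDominated (excessC src dst f' c) (excessC src dst f c)))

  NonNeg : ∀ {k : ℕ} → (Fin k → Carrier) → Set ℓ₂
  NonNeg w = ∀ e → 0# ≤ w e

  Feasible : ∀ {n m k : ℕ} → (Fin k → Fin n) → (Fin k → Fin m) →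
             (s : Fin n → Carrier) → (w : Fin k → Carrier) → Set ℓ₂
  Feasible src dst s w = ∀ v → excessN src dst w v ≤ s v

module Submission where

-- Write a = w e and b = w′ e for an edge e, and let
-- t = f′ e.  Sub-flow condition (a) says that t is "sign-dominated" by the
-- difference b - a: either t ≈ 0, or 0 < t ≤ b - a, or b - a ≤ t < 0.  In
-- each case both a + t and b - t lie in the closed interval spanned by a
-- and b, so they inherit every lower bound and every upper bound common to
-- a and b.  With the common lower bound 0 this gives non-negativity.
--
-- For feasibility at a voter v the same argument is run one level up:
-- the excess f(v) = Σ_{c ∈ C_v} f_{vc} is additive in the flow, so the
-- excesses of w + f′ and w′ - f′ at v are a + t and b - t for a = w(v),
-- b = w′(v) and t = f′(v); condition (b) says that t is sign-dominated by
-- w′(v) - w(v) = b - a, and s v is a common upper bound of a and b.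

open import Defs
open import Level using (Level)
open import Data.Nat using (ℕ)
open import Data.Fin using (Fin)
open import Data.Product using (_×_)
open import Relation.Binary.PropositionalEquality using (_≡_)

open import Data.Product using (_,_)
import Data.Fin as Fin
open import Data.Fin using (_≟_)
open import Relation.Nullary.Decidable using (⌊_⌋)
open import Data.Sum using (_⊎_; inj₁; inj₂)
open import Data.Bool using (Bool; true; false; if_then_else_)
open import Relation.Binary.Structures using (IsTotalOrder)
import Algebra.Properties.AbelianGroup as AbelianGroupProperties
import Algebra.Properties.CommutativeMonoid.Sum as SumProperties
import Relation.Binary.Reasoning.Setoid as SetoidReasoning

module OrderedFieldFacts {c ℓ₁ ℓ₂ : Level} (F : OrderedField c ℓ₁ ℓ₂) where
  open OrderedField F
  open Election F
  open IsTotalOrder isTotalOrder using (total; ≤-respˡ-≈; ≤-respʳ-≈)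
    renaming (trans to ≤-trans; reflexive to ≤-reflexive)
  open AbelianGroupProperties +-abelianGroup
    using (ε⁻¹≈ε; ⁻¹-anti-homo‿-; \\-leftDividesˡ; //-rightDividesˡ; //-rightDividesʳ)
  open SumProperties +-commutativeMonoid using (sum; sum-cong-≋; ∑-distrib-+)
  open SetoidReasoning setoid

  x+[y-x]≈y : ∀ x y → x + (y - x) ≈ y
  x+[y-x]≈y x y = trans (+-comm x (y - x)) (//-rightDividesˡ x y)

  y-[y-x]≈x : ∀ x y → y - (y - x) ≈ x
  y-[y-x]≈x x y = begin
    y - (y - x)  ≈⟨ +-congˡ (⁻¹-anti-homo‿- y x) ⟩
    y + (x - y)  ≈⟨ x+[y-x]≈y y x ⟩
    x            ∎

  x-0≈x : ∀ x → x - 0# ≈ x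
  x-0≈x x = trans (+-congˡ ε⁻¹≈ε) (+-identityʳ x)

  +-monoˡ-≤ : ∀ z {x y} → x ≤ y → z + x ≤ z + y
  +-monoˡ-≤ z {x} {y} x≤y =
    ≤-respʳ-≈ (+-comm y z) (≤-respˡ-≈ (+-comm x z) (+-mono-≤ z x≤y))

  -‿antitone : ∀ {x y} → x ≤ y → - y ≤ - x
  -‿antitone {x} {y} x≤y =
    ≤-respʳ-≈ rhs (≤-respˡ-≈ (\\-leftDividesˡ x (- y)) (+-mono-≤ (- x - y) x≤y))
    where
    rhs : y + (- x - y) ≈ - x
    rhs = trans (+-congˡ (+-comm (- x) (- y))) (\\-leftDividesˡ y (- x))

  -‿nonpos : ∀ {t} → 0# ≤ t → - t ≤ 0#
  -‿nonpos 0≤t = ≤-respʳ-≈ ε⁻¹≈ε (-‿antitone 0≤t)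

  -‿nonneg : ∀ {t} → t ≤ 0# → 0# ≤ - t
  -‿nonneg t≤0 = ≤-respˡ-≈ ε⁻¹≈ε (-‿antitone t≤0)

  Between : Carrier → Carrier → Carrier → Set ℓ₂
  Between x a b = (a ≤ x × x ≤ b) ⊎ (b ≤ x × x ≤ a)

  between-upper : ∀ {x a b u} → Between x a b → a ≤ u → b ≤ u → x ≤ u
  between-upper (inj₁ (_ , x≤b)) a≤u b≤u = ≤-trans x≤b b≤u
  between-upper (inj₂ (_ , x≤a)) a≤u b≤u = ≤-trans x≤a a≤u

  between-lower : ∀ {x a b l} → Between x a b → l ≤ a → l ≤ b → l ≤ x
  between-lower (inj₁ (a≤x , _)) l≤a l≤b = ≤-trans l≤a a≤x
  between-lower (inj₂ (b≤x , _)) l≤a l≤b = ≤-trans l≤b b≤x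

  between-left : ∀ {x a b} → x ≈ a → Between x a b
  between-left {x} {a} {b} x≈a with total a b
  ... | inj₁ a≤b = inj₁ (≤-reflexive (sym x≈a) , ≤-respˡ-≈ (sym x≈a) a≤b)
  ... | inj₂ b≤a = inj₂ (≤-respʳ-≈ (sym x≈a) b≤a , ≤-reflexive x≈a)

  between-right : ∀ {x a b} → x ≈ b → Between x a b
  between-right {x} {a} {b} x≈b with total a b
  ... | inj₁ a≤b = inj₁ (≤-respʳ-≈ (sym x≈b) a≤b , ≤-reflexive x≈b)
  ... | inj₂ b≤a = inj₂ (≤-reflexive (sym x≈b) , ≤-respˡ-≈ (sym x≈b) b≤a)

  sign-dominated-resp : ∀ {t x y} → x ≈ y → SignDominated t x → SignDominated t y
  sign-dominated-resp x≈y (inj₁ t≈0) = inj₁ t≈0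
  sign-dominated-resp x≈y (inj₂ (inj₁ (0<t , t≤x))) = inj₂ (inj₁ (0<t , ≤-respʳ-≈ x≈y t≤x))
  sign-dominated-resp x≈y (inj₂ (inj₂ (t<0 , x≤t))) = inj₂ (inj₂ (t<0 , ≤-respˡ-≈ x≈y x≤t))

  step-from-left : ∀ {a b t} → SignDominated t (b - a) → Between (a + t) a b
  step-from-left {a} {b} {t} (inj₁ t≈0) =
    between-left (trans (+-congˡ t≈0) (+-identityʳ a))
  step-from-left {a} {b} {t} (inj₂ (inj₁ ((0≤t , _) , t≤b-a))) = inj₁
    ( ≤-respˡ-≈ (+-identityʳ a) (+-monoˡ-≤ a 0≤t)
    , ≤-respʳ-≈ (x+[y-x]≈y a b) (+-monoˡ-≤ a t≤b-a) )
  step-from-left {a} {b} {t} (inj₂ (inj₂ ((t≤0 , _) , b-a≤t))) = inj₂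
    ( ≤-respˡ-≈ (x+[y-x]≈y a b) (+-monoˡ-≤ a b-a≤t)
    , ≤-respʳ-≈ (+-identityʳ a) (+-monoˡ-≤ a t≤0) )

  step-from-right : ∀ {a b t} → SignDominated t (b - a) → Between (b - t) a b
  step-from-right {a} {b} {t} (inj₁ t≈0) =
    between-right (trans (+-congˡ (-‿cong t≈0)) (x-0≈x b))
  step-from-right {a} {b} {t} (inj₂ (inj₁ ((0≤t , _) , t≤b-a))) = inj₁
    ( ≤-respˡ-≈ (y-[y-x]≈x a b) (+-monoˡ-≤ b (-‿antitone t≤b-a))
    , ≤-respʳ-≈ (+-identityʳ b) (+-monoˡ-≤ b (-‿nonpos 0≤t)) )
  step-from-right {a} {b} {t} (inj₂ (inj₂ ((t≤0 , _) , b-a≤t))) = inj₂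
    ( ≤-respˡ-≈ (+-identityʳ b) (+-monoˡ-≤ b (-‿nonneg t≤0))
    , ≤-respʳ-≈ (y-[y-x]≈x a b) (+-monoˡ-≤ b (-‿antitone b-a≤t)) )

  -- The finite sum of the election model agrees with the library's
  -- monoid sum, whose congruence and additivity lemmas are then available.
  sumFin≈sum : ∀ {k} (g : Fin k → Carrier) → sumFin g ≈ sum g
  sumFin≈sum {ℕ.zero}  g = refl
  sumFin≈sum {ℕ.suc k} g = +-congˡ (sumFin≈sum (λ i → g (Fin.suc i)))

  sumFin-cong : ∀ {k} {g h : Fin k → Carrier} → (∀ i → g i ≈ h i) → sumFin g ≈ sumFin h
  sumFin-cong {g = g} {h} g≈h =
    trans (sumFin≈sum g) (trans (sum-cong-≋ g≈h) (sym (sumFin≈sum h)))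

  sumFin-+ : ∀ {k} (g h : Fin k → Carrier) →
             sumFin (λ i → g i + h i) ≈ sumFin g + sumFin h
  sumFin-+ g h = begin
    sumFin (λ i → g i + h i)  ≈⟨ sumFin≈sum (λ i → g i + h i) ⟩
    sum (λ i → g i + h i)     ≈⟨ ∑-distrib-+ g h ⟩
    sum g + sum h             ≈⟨ +-cong (sumFin≈sum g) (sumFin≈sum h) ⟨
    sumFin g + sumFin h       ∎

  mask : Bool → Carrier → Carrier
  mask b x = if b then x else 0#

  mask-+ : ∀ b x y → mask b (x + y) ≈ mask b x + mask b y
  mask-+ true  x y = refl
  mask-+ false x y = sym (+-identityʳ 0#)

  mask-cong : ∀ b {x y} → x ≈ y → mask b x ≈ mask b y
  mask-cong true  x≈y = x≈y
  mask-cong false x≈y = refl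

  module Excess {n m k : ℕ} (src : Fin k → Fin n) (dst : Fin k → Fin m) where
    excess : (Fin k → Carrier) → Fin n → Carrier
    excess = excessN src dst

    incident : Fin k → Fin n → Bool
    incident e v = ⌊ src e ≟ v ⌋

    excess-cong : ∀ {f g} → (∀ e → f e ≈ g e) → ∀ v → excess f v ≈ excess g v
    excess-cong f≈g v = sumFin-cong (λ e → mask-cong (incident e v) (f≈g e))

    excess-+ : ∀ f g v → excess (λ e → f e + g e) v ≈ excess f v + excess g v
    excess-+ f g v = begin
      sumFin (λ e → mask (incident e v) (f e + g e))
        ≈⟨ sumFin-cong (λ e → mask-+ (incident e v) (f e) (g e)) ⟩
      sumFin (λ e → mask (incident e v) (f e) + mask (incident e v) (g e))
        ≈⟨ sumFin-+ (λ e → mask (incident e v) (f e)) (λ e → mask (incident e v) (g e)) ⟩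
      excess f v + excess g v
        ∎

    -- Subtraction is preserved because (f - g) + g ≈ f pointwise.
    excess-− : ∀ f g v → excess (λ e → f e - g e) v ≈ excess f v - excess g v
    excess-− f g v = begin
      excess (λ e → f e - g e) v
        ≈⟨ //-rightDividesʳ (excess g v) (excess (λ e → f e - g e) v) ⟨
      excess (λ e → f e - g e) v + excess g v - excess g v
        ≈⟨ +-congʳ (excess-+ (λ e → f e - g e) g v) ⟨
      excess (λ e → (f e - g e) + g e) v - excess g v
        ≈⟨ +-congʳ (excess-cong (λ e → //-rightDividesˡ (g e) (f e)) v) ⟩
      excess f v - excess g v
        ∎

lemma3 : ∀ {c ℓ₁ ℓ₂ : Level} (F : OrderedField c ℓ₁ ℓ₂) →
           let open OrderedField F
               open Election F
           in (n m k : ℕ) (src : Fin k → Fin n) (dst : Fin k → Fin m) →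
              (∀ e e′ → src e ≡ src e′ → dst e ≡ dst e′ → e ≡ e′) →
              (s : Fin n → Carrier) → (∀ v → 0# ≤ s v) →
              (w w′ f′ : Fin k → Carrier) →
              NonNeg w → Feasible src dst s w →
              NonNeg w′ → Feasible src dst s w′ →
              SubFlow src dst f′ (λ e → w′ e - w e) →
              (NonNeg (λ e → w e + f′ e) × Feasible src dst s (λ e → w e + f′ e)) ×
              (NonNeg (λ e → w′ e - f′ e) × Feasible src dst s (λ e → w′ e - f′ e))
lemma3 F n m k src dst _ s _ w w′ f′ w≥0 w-feasible w′≥0 w′-feasible (edge-dom , voter-dom , _) =
    ( (λ e → between-lower (step-from-left (edge-dom e)) (w≥0 e) (w′≥0 e))
    , (λ v → ≤-respˡ-≈ (sym (excess-+ w f′ v))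
               (between-upper (step-from-left (excess-dom v)) (w-feasible v) (w′-feasible v))) )
  , ( (λ e → between-lower (step-from-right (edge-dom e)) (w≥0 e) (w′≥0 e))
    , (λ v → ≤-respˡ-≈ (sym (excess-− w′ f′ v))
               (between-upper (step-from-right (excess-dom v)) (w-feasible v) (w′-feasible v))) )
  where
  open OrderedField F
  open Election F using (SignDominated)
  open OrderedFieldFacts F
  open Excess src dst
  open IsTotalOrder isTotalOrder using (≤-respˡ-≈)

  excess-dom : ∀ v → SignDominated (excess f′ v) (excess w′ v - excess w v)
  excess-dom v = sign-dominated-resp (excess-− w′ w v) (voter-dom v)
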